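{- Let $d=(d_1,\ldots,d_n)$ be a non-increasing sequence of positive integers, $\gamma\in[1,n]$, and $G_{d,\gamma}$ the flow network described in the context. Then $c(S,T)\ge\sum_{i=1}^n d_i$ for every $(S,T)\in\mathscr F_1$ if and only if for every $k\in[0,n-\gamma]$: $\sum_{i=\gamma+1}^{\gamma+k}(d_i-1)\le k(k-1)-(n-\gamma)+\sum_{i=1}^{\gamma}d_i+\sum_{i=\gamma+k+1}^{n}\min\{k,d_i-1\}$.
   Context: The network $G_{d,\gamma}$ has node set $\mathcal V=\{s,t\}\cup X\cup Y\cup X'_S\cup Y'_S$, where $X=\{x_1,\ldots,x_n\}$, $Y=\{y_1,\ldots,y_n\}$, $X_D=\{x_i:i\in[1,\gamma]\}$, $Y_D=\{y_j:j\in[1,\gamma]\}$, $X_S=\{x_i:i\in[\gamma+1,n]\}$, $Y_S=\{y_j:j\in[\gamma+1,n]\}$, $X'_S=\{x'_i:i\in[\gamma+1,n]\}$, $Y'_S=\{y'_j:j\in[\gamma+1,n]\}$. Its directed edges with capacities are: $(s,x_i)$ cap. $d_i$ and $(y_i,t)$ cap. $d_i$ for $i\in[1,n]$; $(x_i,y_j)$ cap. 1 for $i,j\in[1,\gamma]$, $i\ne j$; $(x_i,y_j)$ cap. 1 for $i\in[1,\gamma]$, $j\in[\gamma+1,n]$; $(x_i,y_j)$ cap. 1 for $i\in[\gamma+1,n]$, $j\in[1,\gamma]$; $(x_i,x'_i)$ cap. $d_i-1$ and $(y'_i,y_i)$ cap. $d_i-1$ for $i\in[\gamma+1,n]$; $(x'_i,y'_j)$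 cap. 1 for $i,j\in[\gamma+1,n]$, $i\ne j$. An $s$-$t$ cut is a partition $(S,T)$ of $\mathcal V$ with $s\in S$, $t\in T$; its capacity $c(S,T)$ is the total capacity of edges directed from $S$ to $T$. $\mathscr F_1$ is the family of cuts $(S,\mathcal V\setminus S)$ with $S=\{s\}\cup\{x'_i:i\in I\}\cup\{y'_j:j\in J\}\cup X_S\cup Y_D$ for $I,J\subseteq[\gamma+1,n]$. $[a,b]=\{a,\ldots,b\}$. -}

module Defs where

open import Data.Nat using (ℕ; zero; suc; _+_; _*_; _∸_; _≤_; _<ᵇ_; _≡ᵇ_; _⊓_)
open import Data.Bool using (Bool; true; false; _∧_; not; if_then_else_)
open import Data.Fin using (Fin; toℕ)
open import Data.List using (List; []; _∷_; map; allFin; concatMap; _++_)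
open import Data.Nat.ListAction using (sum)
open import Relation.Binary.PropositionalEquality using (_≡_)
open import Data.Product using (_×_; _,_)

-- Indices are 0-based: the node x_i of the paper (i ∈ [1,n]) is X (i-1),
-- and d_i of the paper is d (i-1).  Index p : Fin n lies in the "D" part
-- ([1,γ] in the paper) iff toℕ p < γ, and in the "S" part ([γ+1,n]) otherwise.

data Node (n : ℕ) : Set where
  src snk : Node n
  X Y X′ Y′ : Fin n → Node n
-- X′ p / Y′ p are genuine nodes of G_{d,γ} only for p in the S part; for p in
-- the D part they are isolated (no incident edges) and so never affect cut capacities.

Edge : ℕ → Set
Edge n = Node n × Node n × ℕ

isD : (γ : ℕ) {n : ℕ} → Fin n → Bool
isD γ p = toℕ p <ᵇ γ

isS : (γ : ℕ) {n : ℕ} → Fin n → Bool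
isS γ p = not (isD γ p)

neq : {n : ℕ} → Fin n → Fin n → Bool
neq p q = not (toℕ p ≡ᵇ toℕ q)

opt : {A : Set} → Bool → A → List A
opt true a = a ∷ []
opt false a = []

edges : (n γ : ℕ) → (Fin n → ℕ) → List (Edge n)
edges n γ d =
     map (λ i → (src , X i , d i)) (allFin n)
  ++ map (λ i → (Y i , snk , d i)) (allFin n)
  ++ concatMap (λ i → concatMap (λ j →
          opt (isD γ i ∧ isD γ j ∧ neq i j) (X i , Y j , 1)
       ++ opt (isD γ i ∧ isS γ j) (X i , Y j , 1)
       ++ opt (isS γ i ∧ isD γ j) (X i , Y j , 1)) (allFin n)) (allFin n)
  ++ concatMap (λ i → opt (isS γ i) (X i , X′ i , d i ∸ 1)
                    ++ opt (isS γ i) (Y′ i , Y i , d i ∸ 1)) (allFin n)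
  ++ concatMap (λ i → concatMap (λ j →
          opt (isS γ i ∧ isS γ j ∧ neq i j) (X′ i , Y′ j , 1)) (allFin n)) (allFin n)

capacity : (n γ : ℕ) → (Fin n → ℕ) → (Node n → Bool) → ℕ
capacity n γ d inS =
  sum (map (λ { (u , v , c) → if inS u ∧ not (inS v) then c else 0 }) (edges n γ d))

F1cut : (n γ : ℕ) → (Fin n → Bool) → (Fin n → Bool) → Node n → Bool
F1cut n γ I J src = true
F1cut n γ I J snk = false
F1cut n γ I J (X p) = isS γ p
F1cut n γ I J (Y p) = isD γ p
F1cut n γ I J (X′ p) = I p
F1cut n γ I J (Y′ p) = J p

SubsetS : {n : ℕ} → ℕ → (Fin n → Bool) → Set
SubsetS γ I = ∀ p → I p ≡ true → γ ≤ toℕ p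

ΣFin : (n : ℕ) → (Fin n → ℕ) → ℕ
ΣFin n f = sum (map f (allFin n))

ΣRange : (n : ℕ) → ℕ → ℕ → (Fin n → ℕ) → ℕ
ΣRange n a b f = ΣFin n (λ p → if (a ≤ᵇ' toℕ p) ∧ (toℕ p <ᵇ b) then f p else 0)
  where
  _≤ᵇ'_ : ℕ → ℕ → Bool
  x ≤ᵇ' y = x <ᵇ suc y

{-# OPTIONS --safe #-}
module Submission where

-- Every cut of F₁ pays Σ_{i≤γ} d_i twice and d_i − 1 for each x_i ∈ X_S ∖ I; beyond
-- that it pays, for each j ∈ S, either d_j − 1 (edge y′_j → y_j, if j ∈ J) or
-- |I ∖ {j}| (edges x′_i → y′_j, if j ∉ J).  Hence the cut bound for (I, J) reads
--   Σ_{i∈I} (d_i − 1) + (n − γ) ≤ Σ_{i≤γ} d_i + Σ_{j∈S} cost_j,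
-- and the best J pays min(d_j − 1, |I ∖ {j}|) at every j.  With I the first k indices
-- of S and J = {j ∉ I : d_j − 1 < k} this is exactly the k-th inequality.
-- Conversely, take any I with |I| = k.  Only its r "heavy" members (d_j − 1 ≥ k) can
-- make the bound tight, and dropping the light ones reduces it to the analogous bound
-- for the heavy set with k replaced by r.  As d is non-increasing, the weight
-- d_j − 1 + min(r, d_j − 1) is too, so by an exchange argument the first r indices of S
-- are the worst r-set: the r-th inequality implies the bound.

open import Defs
open import Data.Bool using (Bool; true; false; _∧_; not; if_then_else_)
open import Data.Bool.Properties using (T-≡; ∧-identityʳ; ∧-zeroʳ; ∧-conicalˡ; not-involutive)
open import Data.Fin using (Fin; toℕ; fromℕ<)
  renaming (zero to fzero; suc to fsuc; _≤_ to _≤F_)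
open import Data.Fin.Properties using (toℕ<n; toℕ-fromℕ<)
open import Data.Integer using (+_; _-_; -_; +≤+) renaming (_+_ to _+ℤ_; _≤_ to _≤ℤ_)
import Data.Integer.Properties as ℤ
import Data.Integer.Tactic.RingSolver as ℤ-Solver
open import Data.List using (List; []; _∷_; map; allFin; concatMap; _++_; tabulate)
open import Data.List.Properties using (map-++; map-tabulate; map-∘)
open import Data.Nat
  using (ℕ; zero; suc; _+_; _*_; _∸_; _≤_; _<_; _⊓_; _<ᵇ_; _≤ᵇ_; _≡ᵇ_; z≤n; s≤s)
open import Data.Nat.ListAction using (sum)
open import Data.Nat.ListAction.Properties using (sum-++)
open import Data.Nat.Properties
open import Data.Nat.Tactic.RingSolver using (solve-∀)
open import Data.Product using (_×_; _,_; ∃-syntax)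
open import Function.Base using (_∘_; id)
open import Function.Bundles using (_⇔_; mk⇔; Equivalence)
open import Relation.Binary.PropositionalEquality
  using (_≡_; refl; sym; trans; cong; cong₂; subst; subst₂; module ≡-Reasoning)
open import Relation.Nullary using (yes; no)
open import Relation.Nullary.Reflects using (ofʸ; ofⁿ)
open import Relation.Nullary.Negation using (contradiction)

open import Algebra.Properties.CommutativeMonoid.Sum +-0-commutativeMonoid
  using (sum-syntax; ∑-distrib-+; ∑-comm; sum-cong-≗; sum-replicate-zero)
  renaming (sum to ∑)
open import Algebra.Properties.Semiring.Sum +-*-semiring using (*-distribˡ-sum)
open import Algebra.Properties.CommutativeSemigroup +-commutativeSemigroup
  using (xy∙z≈xz∙y; x∙yz≈y∙xz; x∙yz≈yx∙z)

-- Sums over subsets of Fin n, subsets being Boolean predicates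

infixr 11 [_]·_
[_]·_ : Bool → ℕ → ℕ
[ b ]· c = if b then c else 0

sumOver : ∀ {n} → (Fin n → Bool) → (Fin n → ℕ) → ℕ
sumOver {n} P f = ∑[ p < n ] [ P p ]· f p

infixl 10 sumOver
syntax sumOver P (λ p → f) = ∑[ p ∈ P ] f

count : ∀ {n} → (Fin n → Bool) → ℕ
count P = sumOver P (λ _ → 1)

infixr 7 _∩_ _∖_
_∩_ _∖_ : ∀ {n} → (Fin n → Bool) → (Fin n → Bool) → Fin n → Bool
(P ∩ Q) p = P p ∧ Q p
(P ∖ Q) p = P p ∧ not (Q p)

⁅_⁆ : ∀ {n} → Fin n → Fin n → Bool
⁅ q ⁆ p = toℕ p ≡ᵇ toℕ q

[]·-mono-≤ : ∀ b {m n} → m ≤ n → [ b ]· m ≤ [ b ]· n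
[]·-mono-≤ true  m≤n = m≤n
[]·-mono-≤ false _   = z≤n

[]·≡*[]·1 : ∀ b c → [ b ]· c ≡ c * [ b ]· 1
[]·≡*[]·1 true  c = sym (*-identityʳ c)
[]·≡*[]·1 false c = sym (*-zeroʳ c)

∑-mono-≤ : ∀ {n} {f g : Fin n → ℕ} → (∀ p → f p ≤ g p) → ∑[ p < n ] f p ≤ ∑[ p < n ] g p
∑-mono-≤ {zero}  _   = z≤n
∑-mono-≤ {suc n} f≤g = +-mono-≤ (f≤g fzero) (∑-mono-≤ (f≤g ∘ fsuc))

∑-[]· : ∀ {n} b (f : Fin n → ℕ) → ∑[ p < n ] [ b ]· f p ≡ [ b ]· (∑[ p < n ] f p)
∑-[]· true      f = refl
∑-[]· {n} false f = sum-replicate-zero n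

∑-distrib-+³ : ∀ {n} (f g h : Fin n → ℕ) →
  ∑[ p < n ] (f p + g p + h p) ≡ ∑[ p < n ] f p + ∑[ p < n ] g p + ∑[ p < n ] h p
∑-distrib-+³ f g h =
  trans (∑-distrib-+ (λ p → f p + g p) h) (cong (_+ ∑[ p < _ ] h p) (∑-distrib-+ f g))

sumOver-const : ∀ {n} (P : Fin n → Bool) c → sumOver P (λ _ → c) ≡ c * count P
sumOver-const P c = trans (sum-cong-≗ (λ p → []·≡*[]·1 (P p) c))
                          (sym (*-distribˡ-sum c (λ p → [ P p ]· 1)))

sumOver-+³ : ∀ {n} (P Q R : Fin n → Bool) (f g : Fin n → ℕ) c →
  ∑[ p < n ] ([ P p ]· f p + [ Q p ]· g p + [ R p ]· c)
    ≡ ∑[ p ∈ P ] f p + ∑[ p ∈ Q ] g p + c * count R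
sumOver-+³ P Q R f g c =
  trans (∑-distrib-+³ (λ p → [ P p ]· f p) (λ p → [ Q p ]· g p) (λ p → [ R p ]· c))
        (cong (_+_ (∑[ p ∈ P ] f p + ∑[ p ∈ Q ] g p)) (sumOver-const R c))

count-without : ∀ {n} (I : Fin n → Bool) j → count (I ∖ ⁅ j ⁆) + [ I j ]· 1 ≡ count I
count-without {suc n} I fzero = begin
  [ I fzero ∧ false ]· 1 + count (λ i → I (fsuc i) ∧ true) + [ I fzero ]· 1
    ≡⟨ cong₂ (λ b c → [ b ]· 1 + c + [ I fzero ]· 1) (∧-zeroʳ (I fzero))
             (sum-cong-≗ (λ i → cong ([_]· 1) (∧-identityʳ (I (fsuc i))))) ⟩
  count (I ∘ fsuc) + [ I fzero ]· 1
    ≡⟨ +-comm (count (I ∘ fsuc)) _ ⟩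
  count I ∎
  where open ≡-Reasoning
count-without {suc n} I (fsuc j) = begin
  [ I fzero ∧ true ]· 1 + count ((I ∘ fsuc) ∖ ⁅ j ⁆) + [ I (fsuc j) ]· 1
    ≡⟨ +-assoc ([ I fzero ∧ true ]· 1) _ _ ⟩
  [ I fzero ∧ true ]· 1 + (count ((I ∘ fsuc) ∖ ⁅ j ⁆) + [ I (fsuc j) ]· 1)
    ≡⟨ cong₂ _+_ (cong ([_]· 1) (∧-identityʳ (I fzero))) (count-without (I ∘ fsuc) j) ⟩
  count I ∎
  where open ≡-Reasoning

count-split : ∀ {n} (I K : Fin n → Bool) → count (I ∖ K) + count (I ∩ K) ≡ count I
count-split I K =
  trans (sym (∑-distrib-+ (λ p → [ (I ∖ K) p ]· 1) (λ p → [ (I ∩ K) p ]· 1)))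
        (sum-cong-≗ (λ p → split (I p) (K p)))
  where
  split : ∀ b c → [ b ∧ not c ]· 1 + [ b ∧ c ]· 1 ≡ [ b ]· 1
  split true  true  = refl
  split true  false = refl
  split false _     = refl

<ᵇ-true : ∀ {m n} → m < n → (m <ᵇ n) ≡ true
<ᵇ-true {zero}  {suc n} _         = refl
<ᵇ-true {suc m} {suc n} (s≤s m<n) = <ᵇ-true m<n

<ᵇ-false : ∀ {m n} → n ≤ m → (m <ᵇ n) ≡ false
<ᵇ-false {m}     {zero}  _         = refl
<ᵇ-false {suc m} {suc n} (s≤s n≤m) = <ᵇ-false n≤m

if-<ᵇ-⊓ : ∀ a k → (if a <ᵇ k then a else k) ≡ k ⊓ a
if-<ᵇ-⊓ a k with a <ᵇ k | <ᵇ-reflects-< a k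
... | true  | ofʸ a<k = sym (m≥n⇒m⊓n≡n (<⇒≤ a<k))
... | false | ofⁿ a≮k = sym (m≤n⇒m⊓n≡m (≮⇒≥ a≮k))

n≤o∸m⇒m+n≤o : ∀ {m n o} → m ≤ o → n ≤ o ∸ m → m + n ≤ o
n≤o∸m⇒m+n≤o {m} {n} {o} m≤o n≤o∸m = subst (_≤ o) (+-comm n m) (m≤o∸n⇒m+n≤o n m≤o n≤o∸m)

r[r∸1]+rs≡[s+r∸1]r : ∀ r s → r * (r ∸ 1) + r * s ≡ (s + r ∸ 1) * r
r[r∸1]+rs≡[s+r∸1]r zero    s = sym (*-zeroʳ (s + 0 ∸ 1))
r[r∸1]+rs≡[s+r∸1]r (suc r) s = begin
  suc r * r + suc r * s   ≡⟨ *-distribˡ-+ (suc r) r s ⟨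
  suc r * (r + s)         ≡⟨ *-comm (suc r) (r + s) ⟩
  (r + s) * suc r         ≡⟨ cong (_* suc r) (+-comm r s) ⟩
  (s + r) * suc r         ≡⟨ cong (λ t → (t ∸ 1) * suc r) (+-suc s r) ⟨
  (s + suc r ∸ 1) * suc r ∎
  where open ≡-Reasoning

i≤j-k⇔i+k≤j : ∀ i j k → i ≤ℤ j - k ⇔ i +ℤ k ≤ℤ j
i≤j-k⇔i+k≤j i j k = mk⇔
  (λ i≤j-k → subst (i +ℤ k ≤ℤ_) (j-k+k≡j j k) (ℤ.+-monoˡ-≤ k i≤j-k))
  (λ i+k≤j → subst (_≤ℤ j - k) (i+k-k≡i i k) (ℤ.+-monoˡ-≤ (- k) i+k≤j))
  where
  j-k+k≡j : ∀ j k → j - k +ℤ k ≡ j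
  j-k+k≡j = ℤ-Solver.solve-∀
  i+k-k≡i : ∀ i k → i +ℤ k - k ≡ i
  i+k-k≡i = ℤ-Solver.solve-∀

+x≤y-m+z+w⇔x+m≤y+z+w : ∀ x m y z w →
  + x ≤ℤ ((+ y - + m) +ℤ + z) +ℤ + w ⇔ x + m ≤ y + z + w
+x≤y-m+z+w⇔x+m≤y+z+w x m y z w = subst (λ t → + x ≤ℤ t ⇔ x + m ≤ y + z + w) (sym rhs≡) (mk⇔
  (λ h → ℤ.drop‿+≤+ (subst (_≤ℤ + (y + z + w)) (sym (ℤ.pos-+ x m)) (Equivalence.to shift h)))
  (λ h → Equivalence.from shift (subst (_≤ℤ + (y + z + w)) (ℤ.pos-+ x m) (+≤+ h))))
  where
  shift : + x ≤ℤ + (y + z + w) - + m ⇔ + x +ℤ + m ≤ℤ + (y + z + w)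
  shift = i≤j-k⇔i+k≤j (+ x) (+ (y + z + w)) (+ m)
  regroup : ∀ y m z w → ((y - m) +ℤ z) +ℤ w ≡ ((y +ℤ z) +ℤ w) - m
  regroup = ℤ-Solver.solve-∀
  rhs≡ : ((+ y - + m) +ℤ + z) +ℤ + w ≡ + (y + z + w) - + m
  rhs≡ = trans (regroup (+ y) (+ m) (+ z) (+ w))
               (cong (_- + m) (sym (trans (ℤ.pos-+ (y + z) w) (cong (_+ℤ + w) (ℤ.pos-+ y z)))))

-- Windows of indices and antitone weights

inRange : ℕ → ℕ → ℕ → Bool
inRange a b t = (a <ᵇ suc t) ∧ (t <ᵇ b)

window : ∀ {n} → ℕ → ℕ → Fin n → Bool
window a b p = inRange a b (toℕ p)

window⇒≤ : ∀ {n} a b (p : Fin n) → window a b p ≡ true → a ≤ toℕ p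
window⇒≤ a b p e = ≤-pred (<ᵇ⇒< a (suc (toℕ p)) (Equivalence.from T-≡ (∧-conicalˡ _ _ e)))

count-window : ∀ n a b → count {n} (window a b) ≡ b ⊓ n ∸ a
count-window zero    a       b       = sym (trans (cong (_∸ a) (⊓-zeroʳ b)) (0∸n≡0 a))
count-window (suc n) zero    zero    = sum-replicate-zero (suc n)
count-window (suc n) zero    (suc b) = cong suc (count-window n zero b)
count-window (suc n) (suc a) zero    =
  trans (sum-cong-≗ {suc n} (λ p → cong ([_]· 1) (∧-zeroʳ (suc a <ᵇ suc (toℕ p)))))
        (sum-replicate-zero (suc n))
count-window (suc n) (suc a) (suc b) = count-window n a b

count-window-≤ : ∀ {n} γ k → γ + k ≤ n → count {n} (window γ (γ + k)) ≡ k
count-window-≤ {n} γ k γ+k≤n =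
  trans (count-window n γ (γ + k)) (trans (cong (_∸ γ) (m≤n⇒m⊓n≡m γ+k≤n)) (m+n∸m≡n γ k))

data Position (γ B t : ℕ) : Bool → Bool → Bool → Set where
  below  : t < γ → Position γ B t true  false false
  inside : t < B → Position γ B t false true  false
  above  : B ≤ t → Position γ B t false false true

position : ∀ {γ B n} t → γ ≤ B → t < n →
           Position γ B t (t <ᵇ γ) (inRange γ B t) (inRange B n t)
position {γ} {B} t γ≤B t<n with t <? γ | t <? B
... | yes t<γ | _
  rewrite <ᵇ-true t<γ | <ᵇ-false {γ} {suc t} t<γ | <ᵇ-false {B} {suc t} (≤-trans t<γ γ≤B)
  = below t<γ
... | no t≮γ | yes t<B
  rewrite <ᵇ-false (≮⇒≥ t≮γ) | <ᵇ-true (s≤s (≮⇒≥ t≮γ)) | <ᵇ-true t<B | <ᵇ-false {B} {suc t} t<B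
  = inside t<B
... | no t≮γ | no t≮B
  rewrite <ᵇ-false (≮⇒≥ t≮γ) | <ᵇ-true (s≤s (≮⇒≥ t≮γ))
        | <ᵇ-false (≮⇒≥ t≮B) | <ᵇ-true (s≤s (≮⇒≥ t≮B)) | <ᵇ-true t<n
  = above (≮⇒≥ t≮B)

isS≡window : ∀ {n γ} → γ ≤ n → (p : Fin n) → isS γ p ≡ window γ n p
isS≡window {n} {γ} γ≤n p
  with isD γ p | window γ n p | window {n} n n p | position (toℕ p) γ≤n (toℕ<n p)
... | .true  | .false | .false | below _   = refl
... | .false | .true  | .false | inside _  = refl
... | .false | .false | .true  | above n≤p = contradiction (toℕ<n p) (≤⇒≯ n≤p)

count-isS : ∀ {n γ} → γ ≤ n → count {n} (isS γ) ≡ n ∸ γ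
count-isS {n} {γ} γ≤n =
  trans (sum-cong-≗ (λ p → cong ([_]· 1) (isS≡window γ≤n p)))
        (trans (count-window n γ n) (cong (_∸ γ) (⊓-idem n)))

subset⇒isS : ∀ {n γ} {I : Fin n → Bool} → SubsetS γ I → ∀ p → I p ≡ true → isS γ p ≡ true
subset⇒isS I⊆S p Ip = cong not (<ᵇ-false (I⊆S p Ip))

count-subset : ∀ {n γ} {I : Fin n → Bool} → γ ≤ n → SubsetS γ I → count I ≤ n ∸ γ
count-subset {n} {γ} {I} γ≤n I⊆S = ≤-trans (∑-mono-≤ pointwise) (≤-reflexive (count-isS γ≤n))
  where
  pointwise : ∀ p → [ I p ]· 1 ≤ [ isS γ p ]· 1
  pointwise p with I p in Ip
  ... | true rewrite subset⇒isS I⊆S p Ip = ≤-refl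
  ... | false = z≤n

Antitone : ∀ {n} → (Fin n → ℕ) → Set
Antitone {n} f = ∀ (p q : Fin n) → toℕ p ≤ toℕ q → f q ≤ f p

antitone-threshold : ∀ {n} (g : Fin n → ℕ) → Antitone g → ∀ B →
  ∃[ v ] ((∀ j → toℕ j < B → v ≤ g j) × (∀ j → B ≤ toℕ j → g j ≤ v))
antitone-threshold {n} g g↓ B with B <? n
... | yes B<n = g (fromℕ< B<n)
              , (λ j j<B → g↓ j _ (≤-trans (<⇒≤ j<B) (≤-reflexive (sym (toℕ-fromℕ< B<n)))))
              , (λ j B≤j → g↓ _ j (≤-trans (≤-reflexive (toℕ-fromℕ< B<n)) B≤j))
... | no  B≮n = 0 , (λ _ _ → z≤n) , (λ j B≤j → contradiction (≤-<-trans B≤j (toℕ<n j)) B≮n)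

-- Σ_A f − Σ_{S∖A} m = Σ_A (f + m) − Σ_S m, and the threshold v shows that among sets
-- of the window's size the window maximises Σ_A (f + m).
exchange : ∀ {n} γ {A : Fin n → Bool} (f m : Fin n → ℕ) {B} v → γ ≤ B → SubsetS γ A →
  count A ≡ count {n} (window γ B) →
  (∀ j → toℕ j < B → v ≤ f j + m j) → (∀ j → B ≤ toℕ j → f j + m j ≤ v) →
  ∑[ p ∈ A ] f p + ∑[ p ∈ window B n ] m p ≤ ∑[ p ∈ window γ B ] f p + ∑[ p ∈ isS γ ∖ A ] m p
exchange {n} γ {A} f m {B} v γ≤B A⊆S |A|≡|P| v≤f+m f+m≤v =
  +-cancelʳ-≤ (v * count A) _ _ (begin
    ∑[ p ∈ A ] f p + ∑[ p ∈ U ] m p + v * count A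
      ≡⟨ cong (λ c → ∑[ p ∈ A ] f p + ∑[ p ∈ U ] m p + v * c) |A|≡|P| ⟩
    ∑[ p ∈ A ] f p + ∑[ p ∈ U ] m p + v * count P
      ≡⟨ sumOver-+³ A U P f m v ⟨
    ∑[ j < n ] ([ A j ]· f j + [ U j ]· m j + [ P j ]· v)
      ≤⟨ ∑-mono-≤ pointwise ⟩
    ∑[ j < n ] ([ P j ]· f j + [ (isS γ ∖ A) j ]· m j + [ A j ]· v)
      ≡⟨ sumOver-+³ P (isS γ ∖ A) A f m v ⟩
    ∑[ p ∈ P ] f p + ∑[ p ∈ isS γ ∖ A ] m p + v * count A ∎)
  where
  open ≤-Reasoning
  P U : Fin n → Bool
  P = window γ B
  U = window B n

  pointwise : ∀ j → [ A j ]· f j + [ U j ]· m j + [ P j ]· v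
                  ≤ [ P j ]· f j + [ not (isD γ j) ∧ not (A j) ]· m j + [ A j ]· v
  pointwise j with isD γ j | P j | U j | A j | position (toℕ j) γ≤B (toℕ<n j) | subset⇒isS A⊆S j
  ... | .true  | .false | .false | true  | below _    | A⇒S = contradiction (A⇒S refl) λ ()
  ... | .true  | .false | .false | false | below _    | _   = z≤n
  ... | .false | .true  | .false | true  | inside _   | _   = ≤-refl
  ... | .false | .true  | .false | false | inside j<B | _   =
    ≤-trans (v≤f+m j j<B) (≤-reflexive (sym (+-identityʳ _)))
  ... | .false | .false | .true  | true  | above B≤j  | _   =
    ≤-trans (≤-reflexive (+-identityʳ _)) (f+m≤v j B≤j)
  ... | .false | .false | .true  | false | above _    | _   = ≤-refl

sum-map-++ : ∀ {A : Set} (w : A → ℕ) xs ys →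
  sum (map w (xs ++ ys)) ≡ sum (map w xs) + sum (map w ys)
sum-map-++ w xs ys = trans (cong sum (map-++ w xs ys)) (sum-++ (map w xs) (map w ys))

sum-map-opt : ∀ {A : Set} (w : A → ℕ) b x → sum (map w (opt b x)) ≡ [ b ]· w x
sum-map-opt w true  x = +-identityʳ (w x)
sum-map-opt w false x = refl

sum-tabulate : ∀ {n} (f : Fin n → ℕ) → sum (tabulate f) ≡ ∑[ p < n ] f p
sum-tabulate {zero}  f = refl
sum-tabulate {suc n} f = cong (_+_ (f fzero)) (sum-tabulate (f ∘ fsuc))

ΣFin≡∑ : ∀ n f → ΣFin n f ≡ ∑[ p < n ] f p
ΣFin≡∑ n f = trans (cong sum (map-tabulate id f)) (sum-tabulate f)

sum-map-map-allFin : ∀ {A : Set} {n} (w : A → ℕ) (g : Fin n → A) →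
  sum (map w (map g (allFin n))) ≡ ∑[ p < n ] w (g p)
sum-map-map-allFin {n = n} w g = trans (cong sum (sym (map-∘ (allFin n)))) (ΣFin≡∑ n (w ∘ g))

sum-map-concatMap-allFin : ∀ {A : Set} {n} (w : A → ℕ) (g : Fin n → List A) →
  sum (map w (concatMap g (allFin n))) ≡ ∑[ p < n ] sum (map w (g p))
sum-map-concatMap-allFin {n = n} w g = trans (sum-map-concatMap (allFin n)) (ΣFin≡∑ n _)
  where
  sum-map-concatMap : ∀ xs →
    sum (map w (concatMap g xs)) ≡ sum (map (λ x → sum (map w (g x))) xs)
  sum-map-concatMap []       = refl
  sum-map-concatMap (x ∷ xs) = trans (sum-map-++ w (g x) (concatMap g xs))
                                     (cong (_+_ (sum (map w (g x)))) (sum-map-concatMap xs))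

module Network (n γ : ℕ) (d : Fin n → ℕ) where

  ΣD : ℕ
  ΣD = ∑[ p ∈ isD γ ] d p

  Condition : ℕ → Set
  Condition k = ∑[ p ∈ window γ (γ + k) ] (d p ∸ 1) + (n ∸ γ)
              ≤ k * (k ∸ 1) + ΣD + ∑[ p ∈ window (γ + k) n ] (k ⊓ (d p ∸ 1))

  condition⇔ : ∀ k →
    + ΣRange n γ (γ + k) (λ p → d p ∸ 1)
      ≤ℤ (((+ (k * (k ∸ 1)) - + (n ∸ γ)) +ℤ + ΣRange n 0 γ d)
          +ℤ + ΣRange n (γ + k) n (λ p → k ⊓ (d p ∸ 1)))
    ⇔ Condition k
  condition⇔ k
    rewrite ΣFin≡∑ n (λ p → [ window γ (γ + k) p ]· (d p ∸ 1))
          | ΣFin≡∑ n (λ p → [ isD γ p ]· d p)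
          | ΣFin≡∑ n (λ p → [ window (γ + k) n p ]· (k ⊓ (d p ∸ 1)))
    = +x≤y-m+z+w⇔x+m≤y+z+w _ _ _ _ _

  crossing : (Node n → Bool) → Node n → Node n → ℕ → ℕ
  crossing inS u v c = [ inS u ∧ not (inS v) ]· c

  capacity-by-edge-groups : ∀ inS → capacity n γ d inS ≡
      ∑[ i < n ] crossing inS src (X i) (d i)
    + (∑[ i < n ] crossing inS (Y i) snk (d i)
    + (∑[ i < n ] ∑[ j < n ] ([ isD γ i ∧ isD γ j ∧ neq i j ]· crossing inS (X i) (Y j) 1
                            + ([ isD γ i ∧ isS γ j ]· crossing inS (X i) (Y j) 1
                            +  [ isS γ i ∧ isD γ j ]· crossing inS (X i) (Y j) 1))
    + (∑[ i < n ] ([ isS γ i ]· crossing inS (X i) (X′ i) (d i ∸ 1)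
                 + [ isS γ i ]· crossing inS (Y′ i) (Y i) (d i ∸ 1))
    + ∑[ i < n ] ∑[ j < n ] [ isS γ i ∧ isS γ j ∧ neq i j ]· crossing inS (X′ i) (Y′ j) 1)))
  capacity-by-edge-groups inS =
    trans (sum-map-++ w (map _ (allFin n)) _) (cong₂ _+_ (sum-map-map-allFin {n = n} w _)
    (trans (sum-map-++ w (map _ (allFin n)) _) (cong₂ _+_ (sum-map-map-allFin {n = n} w _)
    (trans (sum-map-++ w (concatMap _ (allFin n)) _) (cong₂ _+_
      (sum-map-concatMap²-allFin (λ i j → sum-map-opt³
        (isD γ i ∧ isD γ j ∧ neq i j) (isD γ i ∧ isS γ j) (isS γ i ∧ isD γ j) (X i , Y j , 1)))
    (trans (sum-map-++ w (concatMap _ (allFin n)) _) (cong₂ _+_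
      (trans (sum-map-concatMap-allFin {n = n} w _) (sum-cong-≗ {n} λ i →
        sum-map-opt² (isS γ i) (X i , X′ i , d i ∸ 1) (isS γ i) (Y′ i , Y i , d i ∸ 1)))
      (sum-map-concatMap²-allFin (λ i j →
        sum-map-opt w (isS γ i ∧ isS γ j ∧ neq i j) (X′ i , Y′ j , 1))))))))))
    where
    w : Edge n → ℕ
    w (u , v , c) = crossing inS u v c

    sum-map-opt² : ∀ b x c y → sum (map w (opt b x ++ opt c y)) ≡ [ b ]· w x + [ c ]· w y
    sum-map-opt² b x c y =
      trans (sum-map-++ w (opt b x) _) (cong₂ _+_ (sum-map-opt w b x) (sum-map-opt w c y))

    sum-map-opt³ : ∀ b c e x →
      sum (map w (opt b x ++ opt c x ++ opt e x)) ≡ [ b ]· w x + ([ c ]· w x + [ e ]· w x)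
    sum-map-opt³ b c e x =
      trans (sum-map-++ w (opt b x) _) (cong₂ _+_ (sum-map-opt w b x) (sum-map-opt² c x e x))

    sum-map-concatMap²-allFin : ∀ {g : Fin n → Fin n → List (Edge n)} {f : Fin n → Fin n → ℕ} →
      (∀ i j → sum (map w (g i j)) ≡ f i j) →
      sum (map w (concatMap (λ i → concatMap (g i) (allFin n)) (allFin n)))
        ≡ ∑[ i < n ] ∑[ j < n ] f i j
    sum-map-concatMap²-allFin g≡f =
      trans (sum-map-concatMap-allFin {n = n} w _) (sum-cong-≗ {n} λ i →
        trans (sum-map-concatMap-allFin {n = n} w _) (sum-cong-≗ {n} (g≡f i)))

  F1-source-edges : ∀ I J → ∑[ i < n ] crossing (F1cut n γ I J) src (X i) (d i) ≡ ΣD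
  F1-source-edges I J = sum-cong-≗ {n} λ i → cong ([_]· d i) (not-involutive (isD γ i))

  F1-sink-edges : ∀ I J → ∑[ i < n ] crossing (F1cut n γ I J) (Y i) snk (d i) ≡ ΣD
  F1-sink-edges I J = sum-cong-≗ {n} λ i → cong ([_]· d i) (∧-identityʳ (isD γ i))

  F1-X→Y-edges : ∀ I J →
    ∑[ i < n ] ∑[ j < n ] ([ isD γ i ∧ isD γ j ∧ neq i j ]· crossing (F1cut n γ I J) (X i) (Y j) 1
                        + ([ isD γ i ∧ isS γ j ]· crossing (F1cut n γ I J) (X i) (Y j) 1
                        +  [ isS γ i ∧ isD γ j ]· crossing (F1cut n γ I J) (X i) (Y j) 1)) ≡ 0
  F1-X→Y-edges I J =
    trans (sum-cong-≗ {n} λ i →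
             trans (sum-cong-≗ {n} λ j → uncut (isD γ i) (isD γ j) (neq i j))
                   (sum-replicate-zero n))
          (sum-replicate-zero n)
    where
    uncut : ∀ x y e →
        [ x ∧ y ∧ e ]· [ not x ∧ not y ]· 1
      + ([ x ∧ not y ]· [ not x ∧ not y ]· 1 + [ not x ∧ y ]· [ not x ∧ not y ]· 1) ≡ 0
    uncut true  true  true  = refl
    uncut true  true  false = refl
    uncut true  false _     = refl
    uncut false true  _     = refl
    uncut false false _     = refl

  F1-split-edges : ∀ I {J} → SubsetS γ J →
    ∑[ i < n ] ([ isS γ i ]· crossing (F1cut n γ I J) (X i) (X′ i) (d i ∸ 1)
              + [ isS γ i ]· crossing (F1cut n γ I J) (Y′ i) (Y i) (d i ∸ 1))
      ≡ ∑[ p ∈ isS γ ∖ I ] (d p ∸ 1) + ∑[ p ∈ J ] (d p ∸ 1)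
  F1-split-edges I {J} J⊆S =
    trans (sum-cong-≗ {n} λ i → split (isS γ i) (I i) (J i) (subset⇒isS J⊆S i))
          (∑-distrib-+ (λ i → [ (isS γ ∖ I) i ]· (d i ∸ 1)) (λ i → [ J i ]· (d i ∸ 1)))
    where
    split : ∀ s i j {c} → (j ≡ true → s ≡ true) →
            [ s ]· [ s ∧ not i ]· c + [ s ]· [ j ∧ s ]· c ≡ [ s ∧ not i ]· c + [ j ]· c
    split true  _ true  _   = refl
    split true  _ false _   = refl
    split false _ true  J⇒S = contradiction (J⇒S refl) λ ()
    split false _ false _   = refl

  F1-X′→Y′-edges : ∀ {I} J → SubsetS γ I →
    ∑[ i < n ] ∑[ j < n ] [ isS γ i ∧ isS γ j ∧ neq i j ]· crossing (F1cut n γ I J) (X′ i) (Y′ j) 1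
      ≡ ∑[ j ∈ isS γ ∖ J ] count (I ∖ ⁅ j ⁆)
  F1-X′→Y′-edges {I} J I⊆S = begin
    ∑[ i < n ] ∑[ j < n ] [ isS γ i ∧ isS γ j ∧ neq i j ]· [ I i ∧ not (J j) ]· 1
      ≡⟨ sum-cong-≗ {n} (λ i → sum-cong-≗ {n} λ j →
           reindex (isS γ i) (isS γ j) (neq i j) (I i) (J j) (subset⇒isS I⊆S i)) ⟩
    ∑[ i < n ] ∑[ j < n ] [ (isS γ ∖ J) j ]· [ (I ∖ ⁅ j ⁆) i ]· 1
      ≡⟨ ∑-comm (λ i j → [ (isS γ ∖ J) j ]· [ (I ∖ ⁅ j ⁆) i ]· 1) ⟩
    ∑[ j < n ] ∑[ i < n ] [ (isS γ ∖ J) j ]· [ (I ∖ ⁅ j ⁆) i ]· 1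
      ≡⟨ sum-cong-≗ {n} (λ j → ∑-[]· ((isS γ ∖ J) j) (λ i → [ (I ∖ ⁅ j ⁆) i ]· 1)) ⟩
    ∑[ j ∈ isS γ ∖ J ] count (I ∖ ⁅ j ⁆) ∎
    where
    open ≡-Reasoning
    reindex : ∀ si sj e i j → (i ≡ true → si ≡ true) →
              [ si ∧ sj ∧ e ]· [ i ∧ not j ]· 1 ≡ [ sj ∧ not j ]· [ i ∧ e ]· 1
    reindex false _     _     true  _     I⇒S = contradiction (I⇒S refl) λ ()
    reindex false false _     false _     _   = refl
    reindex false true  _     false true  _   = refl
    reindex false true  _     false false _   = refl
    reindex true  false _     _     _     _   = refl
    reindex true  true  true  true  true  _   = refl
    reindex true  true  true  true  false _   = refl
    reindex true  true  true  false true  _   = refl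
    reindex true  true  true  false false _   = refl
    reindex true  true  false true  true  _   = refl
    reindex true  true  false true  false _   = refl
    reindex true  true  false false true  _   = refl
    reindex true  true  false false false _   = refl

  -- What the cut pays at y′_j for j in S: the edge y′_j → y_j if y′_j is on the
  -- source side, otherwise the edges x′_i → y′_j for i ∈ I ∖ {j}.
  y′Cost : (I J : Fin n → Bool) → Fin n → ℕ
  y′Cost I J j = if J j then d j ∸ 1 else count (I ∖ ⁅ j ⁆)

  F1-y′-edges : ∀ I {J} → SubsetS γ J →
    ∑[ p ∈ J ] (d p ∸ 1) + ∑[ j ∈ isS γ ∖ J ] count (I ∖ ⁅ j ⁆) ≡ ∑[ j ∈ isS γ ] y′Cost I J j
  F1-y′-edges I {J} J⊆S =
    trans (sym (∑-distrib-+ (λ j → [ J j ]· (d j ∸ 1))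
                            (λ j → [ (isS γ ∖ J) j ]· count (I ∖ ⁅ j ⁆))))
          (sum-cong-≗ {n} λ j → merge (isS γ j) (J j) (subset⇒isS J⊆S j))
    where
    merge : ∀ s j {a c} → (j ≡ true → s ≡ true) →
            [ j ]· a + [ s ∧ not j ]· c ≡ [ s ]· (if j then a else c)
    merge true  true  _   = +-identityʳ _
    merge true  false _   = refl
    merge false true  J⇒S = contradiction (J⇒S refl) λ ()
    merge false false _   = refl

  capacity-F1cut : ∀ {I J} → SubsetS γ I → SubsetS γ J →
    capacity n γ d (F1cut n γ I J)
      ≡ ΣD + ∑[ p ∈ isS γ ∖ I ] (d p ∸ 1) + (ΣD + ∑[ j ∈ isS γ ] y′Cost I J j)
  capacity-F1cut {I} {J} I⊆S J⊆S = begin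
    capacity n γ d (F1cut n γ I J)
      ≡⟨ capacity-by-edge-groups (F1cut n γ I J) ⟩
    _ ≡⟨ cong₂ _+_ (F1-source-edges I J) (cong₂ _+_ (F1-sink-edges I J) (cong₂ _+_ (F1-X→Y-edges I J)
           (cong₂ _+_ (F1-split-edges I J⊆S) (F1-X′→Y′-edges J I⊆S)))) ⟩
    ΣD + (ΣD + (ΣS∖I + ∑[ p ∈ J ] (d p ∸ 1) + ∑[ j ∈ isS γ ∖ J ] count (I ∖ ⁅ j ⁆)))
      ≡⟨ cong (λ t → ΣD + (ΣD + t))
              (trans (+-assoc ΣS∖I _ _) (cong (_+_ ΣS∖I) (F1-y′-edges I J⊆S))) ⟩
    ΣD + (ΣD + (ΣS∖I + Cost))
      ≡⟨ cong (_+_ ΣD) (x∙yz≈y∙xz ΣD ΣS∖I Cost) ⟩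
    ΣD + (ΣS∖I + (ΣD + Cost))
      ≡⟨ +-assoc ΣD ΣS∖I _ ⟨
    ΣD + ΣS∖I + (ΣD + Cost) ∎
    where
    open ≡-Reasoning
    ΣS∖I Cost : ℕ
    ΣS∖I = ∑[ p ∈ isS γ ∖ I ] (d p ∸ 1)
    Cost = ∑[ j ∈ isS γ ] y′Cost I J j

  ΣFin-d-split : (∀ p → 1 ≤ d p) → γ ≤ n → ∀ {I} → SubsetS γ I →
    ΣFin n d ≡ ΣD + ∑[ p ∈ isS γ ∖ I ] (d p ∸ 1) + (∑[ p ∈ I ] (d p ∸ 1) + (n ∸ γ))
  ΣFin-d-split d≥1 γ≤n {I} I⊆S = begin
    ΣFin n d
      ≡⟨ ΣFin≡∑ n d ⟩
    ∑[ p < n ] d p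
      ≡⟨ sum-cong-≗ {n} (λ p → split (isD γ p) (I p) (d≥1 p) (subset⇒isS I⊆S p)) ⟩
    ∑[ p < n ] (f p + g p + (h p + s p))
      ≡⟨ ∑-distrib-+ (λ p → f p + g p) (λ p → h p + s p) ⟩
    ∑[ p < n ] (f p + g p) + ∑[ p < n ] (h p + s p)
      ≡⟨ cong₂ _+_ (∑-distrib-+ f g) (trans (∑-distrib-+ h s) (cong (_+_ _) (count-isS γ≤n))) ⟩
    ΣD + ∑[ p ∈ isS γ ∖ I ] (d p ∸ 1) + (∑[ p ∈ I ] (d p ∸ 1) + (n ∸ γ)) ∎
    where
    open ≡-Reasoning
    f g h s : Fin n → ℕ
    f p = [ isD γ p ]· d p
    g p = [ (isS γ ∖ I) p ]· (d p ∸ 1)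
    h p = [ I p ]· (d p ∸ 1)
    s p = [ isS γ p ]· 1

    split : ∀ x i {c} → 1 ≤ c → (i ≡ true → not x ≡ true) →
            c ≡ [ x ]· c + [ not x ∧ not i ]· (c ∸ 1) + ([ i ]· (c ∸ 1) + [ not x ]· 1)
    split true  true           _ I⇒S = contradiction (I⇒S refl) λ ()
    split true  false {c}      _ _   = sym (trans (+-identityʳ (c + 0)) (+-identityʳ c))
    split false true  {suc c}  _ _   = sym (+-comm c 1)
    split false false {suc c}  _ _   = sym (+-comm c 1)

  F1cut-condition⇔ : (∀ p → 1 ≤ d p) → γ ≤ n → ∀ {I J} → SubsetS γ I → SubsetS γ J →
    ΣFin n d ≤ capacity n γ d (F1cut n γ I J)
      ⇔ ∑[ p ∈ I ] (d p ∸ 1) + (n ∸ γ) ≤ ΣD + ∑[ j ∈ isS γ ] y′Cost I J j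
  F1cut-condition⇔ d≥1 γ≤n {I} {J} I⊆S J⊆S = mk⇔
    (λ cut → +-cancelˡ-≤ shared _ _ (subst₂ _≤_ demand≡ capacity≡ cut))
    (λ bound → subst₂ _≤_ (sym demand≡) (sym capacity≡) (+-monoʳ-≤ shared bound))
    where
    shared : ℕ
    shared = ΣD + ∑[ p ∈ isS γ ∖ I ] (d p ∸ 1)
    demand≡ : ΣFin n d ≡ shared + (∑[ p ∈ I ] (d p ∸ 1) + (n ∸ γ))
    demand≡ = ΣFin-d-split d≥1 γ≤n I⊆S
    capacity≡ : capacity n γ d (F1cut n γ I J) ≡ shared + (ΣD + ∑[ j ∈ isS γ ] y′Cost I J j)
    capacity≡ = capacity-F1cut I⊆S J⊆S

  cheapTail : ℕ → Fin n → Bool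
  cheapTail k = window (γ + k) n ∩ (λ j → d j ∸ 1 <ᵇ k)

  y′Cost-window : ∀ {k} → γ + k ≤ n →
    ∑[ j ∈ isS γ ] y′Cost (window γ (γ + k)) (cheapTail k) j
      ≡ k * (k ∸ 1) + ∑[ j ∈ window (γ + k) n ] (k ⊓ (d j ∸ 1))
  y′Cost-window {k} γ+k≤n = begin
    ∑[ j ∈ isS γ ] y′Cost P (cheapTail k) j
      ≡⟨ sum-cong-≗ {n} pointwise ⟩
    ∑[ j < n ] ([ P j ]· (k ∸ 1) + [ U j ]· (k ⊓ (d j ∸ 1)))
      ≡⟨ ∑-distrib-+ (λ j → [ P j ]· (k ∸ 1)) (λ j → [ U j ]· (k ⊓ (d j ∸ 1))) ⟩
    ∑[ _ ∈ P ] (k ∸ 1) + ∑[ j ∈ U ] (k ⊓ (d j ∸ 1))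
      ≡⟨ cong (_+ ∑[ j ∈ U ] (k ⊓ (d j ∸ 1))) |P|[k∸1]≡k[k∸1] ⟩
    k * (k ∸ 1) + ∑[ j ∈ U ] (k ⊓ (d j ∸ 1)) ∎
    where
    open ≡-Reasoning
    P U : Fin n → Bool
    P = window γ (γ + k)
    U = window (γ + k) n

    |P|≡k : count P ≡ k
    |P|≡k = count-window-≤ γ k γ+k≤n

    |P|[k∸1]≡k[k∸1] : ∑[ _ ∈ P ] (k ∸ 1) ≡ k * (k ∸ 1)
    |P|[k∸1]≡k[k∸1] =
      trans (sumOver-const P (k ∸ 1)) (trans (cong ((k ∸ 1) *_) |P|≡k) (*-comm (k ∸ 1) k))

    pointwise : ∀ j →
      [ not (isD γ j) ]· (if U j ∧ (d j ∸ 1 <ᵇ k) then d j ∸ 1 else count (P ∖ ⁅ j ⁆))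
        ≡ [ P j ]· (k ∸ 1) + [ U j ]· (k ⊓ (d j ∸ 1))
    pointwise j with isD γ j | P j | U j | position (toℕ j) (m≤m+n γ k) (toℕ<n j)
                   | count-without P j
    ... | .true  | .false | .false | below _  | _ = refl
    ... | .false | .true  | .false | inside _ | c+1≡|P| =
      trans (trans (sym (m+n∸n≡m _ 1)) (cong (_∸ 1) (trans c+1≡|P| |P|≡k))) (sym (+-identityʳ _))
    ... | .false | .false | .true  | above _  | c+0≡|P| =
      trans (cong (λ c → if d j ∸ 1 <ᵇ k then d j ∸ 1 else c)
                  (trans (sym (+-identityʳ _)) (trans c+0≡|P| |P|≡k)))
            (if-<ᵇ-⊓ (d j ∸ 1) k)

  cut-bounds⇒Condition : (∀ p → 1 ≤ d p) → γ ≤ n →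
    (∀ I J → SubsetS γ I → SubsetS γ J → ΣFin n d ≤ capacity n γ d (F1cut n γ I J)) →
    ∀ k → k ≤ n ∸ γ → Condition k
  cut-bounds⇒Condition d≥1 γ≤n cut k k≤n∸γ = begin
    ∑[ p ∈ P ] (d p ∸ 1) + (n ∸ γ)
      ≤⟨ Equivalence.to (F1cut-condition⇔ d≥1 γ≤n P⊆S J⊆S) (cut P J P⊆S J⊆S) ⟩
    ΣD + ∑[ j ∈ isS γ ] y′Cost P J j
      ≡⟨ cong (_+_ ΣD) (y′Cost-window (n≤o∸m⇒m+n≤o γ≤n k≤n∸γ)) ⟩
    ΣD + (k * (k ∸ 1) + ΣU)
      ≡⟨ x∙yz≈yx∙z ΣD (k * (k ∸ 1)) ΣU ⟩
    k * (k ∸ 1) + ΣD + ΣU ∎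
    where
    open ≤-Reasoning
    P J : Fin n → Bool
    P = window γ (γ + k)
    J = cheapTail k
    ΣU : ℕ
    ΣU = ∑[ j ∈ window (γ + k) n ] (k ⊓ (d j ∸ 1))
    P⊆S : SubsetS γ P
    P⊆S = window⇒≤ γ (γ + k)
    J⊆S : SubsetS γ J
    J⊆S p Jp = ≤-trans (m≤m+n γ k) (window⇒≤ (γ + k) n p (∧-conicalˡ _ _ Jp))

  large : ℕ → Fin n → Bool
  large k j = k ≤ᵇ d j ∸ 1

  heavy : (Fin n → Bool) → Fin n → Bool
  heavy I = I ∩ large (count I)

  bestCost : (Fin n → Bool) → Fin n → ℕ
  bestCost I j = if I j then (d j ∸ 1) ⊓ (count I ∸ 1) else (d j ∸ 1) ⊓ count I

  bestCost≤y′Cost : ∀ I J j → bestCost I j ≤ y′Cost I J j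
  bestCost≤y′Cost I J j = bound (I j) (J j) (count-without I j)
    where
    bound : ∀ i j {a c k} → c + [ i ]· 1 ≡ k →
            (if i then a ⊓ (k ∸ 1) else a ⊓ k) ≤ (if j then a else c)
    bound true  true  {a}         _     = m⊓n≤m a _
    bound false true  {a}         _     = m⊓n≤m a _
    bound true  false {a} {c} {k} c+1≡k =
      ≤-trans (m⊓n≤n a (k ∸ 1)) (≤-reflexive (trans (cong (_∸ 1) (sym c+1≡k)) (m+n∸n≡m c 1)))
    bound false false {a} {c} {k} c+0≡k =
      ≤-trans (m⊓n≤n a k) (≤-reflexive (trans (sym c+0≡k) (+-identityʳ c)))

  -- Light members of I (d_j − 1 < |I|) are paid for in full by bestCost and heavy ones
  -- are credited |I| − 1 each; as r (|I| − 1) = r (r − 1) + r · #light, this leaves r per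
  -- light member, which covers its min(r, d_j − 1).
  heavy-reduction : ∀ {I} → SubsetS γ I →
    let r = count (heavy I) in
    ∑[ p ∈ I ] (d p ∸ 1) + r * (r ∸ 1) + ∑[ p ∈ isS γ ∖ heavy I ] (r ⊓ (d p ∸ 1))
      ≤ ∑[ p ∈ heavy I ] (d p ∸ 1) + ∑[ j ∈ isS γ ] bestCost I j
  heavy-reduction {I} I⊆S = +-cancelʳ-≤ (r * s) _ _ (begin
    ΣI + r * (r ∸ 1) + M + r * s
      ≡⟨ trans (cong (_+ r * s) (xy∙z≈xz∙y ΣI (r * (r ∸ 1)) M)) (+-assoc (ΣI + M) _ _) ⟩
    ΣI + M + (r * (r ∸ 1) + r * s)
      ≡⟨ cong (_+_ (ΣI + M)) (trans (r[r∸1]+rs≡[s+r∸1]r r s) (cong (λ t → (t ∸ 1) * r) s+r≡k)) ⟩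
    ΣI + M + (k ∸ 1) * r
      ≡⟨ sumOver-+³ I (isS γ ∖ heavy I) (heavy I) a m (k ∸ 1) ⟨
    ∑[ j < n ] ([ I j ]· a j + [ (isS γ ∖ heavy I) j ]· m j + [ heavy I j ]· (k ∸ 1))
      ≤⟨ ∑-mono-≤ (λ j → pointwise (isS γ j) (I j) r≤k (subset⇒isS I⊆S j)) ⟩
    ∑[ j < n ] ([ heavy I j ]· a j + [ isS γ j ]· bestCost I j + [ (I ∖ large k) j ]· r)
      ≡⟨ sumOver-+³ (heavy I) (isS γ) (I ∖ large k) a (bestCost I) r ⟩
    ∑[ p ∈ heavy I ] a p + ∑[ j ∈ isS γ ] bestCost I j + r * s ∎)
    where
    open ≤-Reasoning
    k r s : ℕ
    k = count I
    r = count (heavy I)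
    s = count (I ∖ large k)
    a m : Fin n → ℕ
    a j = d j ∸ 1
    m j = r ⊓ a j
    ΣI M : ℕ
    ΣI = ∑[ p ∈ I ] a p
    M = ∑[ p ∈ isS γ ∖ heavy I ] m p

    s+r≡k : s + r ≡ k
    s+r≡k = count-split I (large k)

    r≤k : r ≤ k
    r≤k = subst (r ≤_) s+r≡k (m≤n+m r s)

    pointwise : ∀ inS inI {x k r} → r ≤ k → (inI ≡ true → inS ≡ true) →
        [ inI ]· x + [ inS ∧ not (inI ∧ (k ≤ᵇ x)) ]· (r ⊓ x) + [ inI ∧ (k ≤ᵇ x) ]· (k ∸ 1)
      ≤ [ inI ∧ (k ≤ᵇ x) ]· x + [ inS ]· (if inI then x ⊓ (k ∸ 1) else x ⊓ k)
        + [ inI ∧ not (k ≤ᵇ x) ]· r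
    pointwise false false _ _ = z≤n
    pointwise false true  _ I⇒S = contradiction (I⇒S refl) λ ()
    pointwise true  false {x} {k} r≤k _ =
      +-monoˡ-≤ 0 (≤-trans (⊓-monoˡ-≤ x r≤k) (≤-reflexive (⊓-comm k x)))
    pointwise true  true  {x} {k} {r} r≤k _ with k ≤ᵇ x | ≤ᵇ-reflects-≤ k x
    ... | true  | ofʸ k≤x = ≤-reflexive (begin-equality
      x + 0 + (k ∸ 1)         ≡⟨ cong (_+ (k ∸ 1)) (+-identityʳ x) ⟩
      x + (k ∸ 1)             ≡⟨ cong (_+_ x) (m≥n⇒m⊓n≡n (≤-trans (m∸n≤m k 1) k≤x)) ⟨
      x + x ⊓ (k ∸ 1)         ≡⟨ +-identityʳ _ ⟨
      x + x ⊓ (k ∸ 1) + 0     ∎)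
    ... | false | ofⁿ k≰x = begin
      x + r ⊓ x + 0           ≡⟨ +-identityʳ _ ⟩
      x + r ⊓ x               ≤⟨ +-monoʳ-≤ x (m⊓n≤m r x) ⟩
      x + r                   ≡⟨ cong (_+ r) (m≤n⇒m⊓n≡m (∸-monoˡ-≤ 1 (≰⇒> k≰x))) ⟨
      x ⊓ (k ∸ 1) + r         ∎

  window-is-worst : Antitone d → γ ≤ n → ∀ {r} → r ≤ n ∸ γ → Condition r →
    ∀ {A} → SubsetS γ A → count A ≡ r →
    ∑[ p ∈ A ] (d p ∸ 1) + (n ∸ γ) ≤ r * (r ∸ 1) + ΣD + ∑[ p ∈ isS γ ∖ A ] (r ⊓ (d p ∸ 1))
  window-is-worst d↓ γ≤n {r} r≤n∸γ condition {A} A⊆S |A|≡r = +-cancelʳ-≤ ΣU _ _ (begin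
    ΣA + (n ∸ γ) + ΣU               ≡⟨ xy∙z≈xz∙y ΣA (n ∸ γ) ΣU ⟩
    ΣA + ΣU + (n ∸ γ)               ≤⟨ +-monoˡ-≤ (n ∸ γ) exchanged ⟩
    ΣP + ΣS∖A + (n ∸ γ)             ≡⟨ xy∙z≈xz∙y ΣP ΣS∖A (n ∸ γ) ⟩
    ΣP + (n ∸ γ) + ΣS∖A             ≤⟨ +-monoˡ-≤ ΣS∖A condition ⟩
    r * (r ∸ 1) + ΣD + ΣU + ΣS∖A    ≡⟨ xy∙z≈xz∙y (r * (r ∸ 1) + ΣD) ΣU ΣS∖A ⟩
    r * (r ∸ 1) + ΣD + ΣS∖A + ΣU    ∎)
    where
    open ≤-Reasoning
    a m g : Fin n → ℕ
    a j = d j ∸ 1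
    m j = r ⊓ a j
    g j = a j + m j
    ΣA ΣU ΣP ΣS∖A : ℕ
    ΣA = ∑[ p ∈ A ] a p
    ΣU = ∑[ p ∈ window (γ + r) n ] m p
    ΣP = ∑[ p ∈ window γ (γ + r) ] a p
    ΣS∖A = ∑[ p ∈ isS γ ∖ A ] m p

    g↓ : Antitone g
    g↓ p q p≤q = +-mono-≤ a↓ (⊓-monoʳ-≤ r a↓)
      where
      a↓ : a q ≤ a p
      a↓ = ∸-monoˡ-≤ 1 (d↓ p q p≤q)

    exchanged : ΣA + ΣU ≤ ΣP + ΣS∖A
    exchanged with antitone-threshold g g↓ (γ + r)
    ... | v , v≤g , g≤v = exchange γ a m v (m≤m+n γ r) A⊆S
      (trans |A|≡r (sym (count-window-≤ γ r (n≤o∸m⇒m+n≤o γ≤n r≤n∸γ)))) v≤g g≤v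

  Conditions⇒cut-bound : Antitone d → γ ≤ n → (∀ k → k ≤ n ∸ γ → Condition k) →
    ∀ {I} J → SubsetS γ I → ∑[ p ∈ I ] (d p ∸ 1) + (n ∸ γ) ≤ ΣD + ∑[ j ∈ isS γ ] y′Cost I J j
  Conditions⇒cut-bound d↓ γ≤n conditions {I} J I⊆S = +-cancelʳ-≤ (R + M) _ _ (begin
    ΣI + (n ∸ γ) + (R + M)   ≡⟨ regroup₁ ΣI (n ∸ γ) R M ⟩
    ΣI + R + M + (n ∸ γ)     ≤⟨ +-monoˡ-≤ (n ∸ γ) (heavy-reduction I⊆S) ⟩
    ΣI′ + Best + (n ∸ γ)     ≡⟨ xy∙z≈xz∙y ΣI′ Best (n ∸ γ) ⟩
    ΣI′ + (n ∸ γ) + Best     ≤⟨ +-monoˡ-≤ Best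
                                  (window-is-worst d↓ γ≤n r≤n∸γ (conditions r r≤n∸γ) I′⊆S refl) ⟩
    R + ΣD + M + Best        ≤⟨ +-monoʳ-≤ (R + ΣD + M)
                                  (∑-mono-≤ λ j → []·-mono-≤ (isS γ j) (bestCost≤y′Cost I J j)) ⟩
    R + ΣD + M + Cost        ≡⟨ regroup₂ R ΣD M Cost ⟩
    ΣD + Cost + (R + M)      ∎)
    where
    open ≤-Reasoning
    r R M ΣI ΣI′ Best Cost : ℕ
    r = count (heavy I)
    R = r * (r ∸ 1)
    M = ∑[ p ∈ isS γ ∖ heavy I ] (r ⊓ (d p ∸ 1))
    ΣI = ∑[ p ∈ I ] (d p ∸ 1)
    ΣI′ = ∑[ p ∈ heavy I ] (d p ∸ 1)
    Best = ∑[ j ∈ isS γ ] bestCost I j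
    Cost = ∑[ j ∈ isS γ ] y′Cost I J j

    I′⊆S : SubsetS γ (heavy I)
    I′⊆S p I′p = I⊆S p (∧-conicalˡ _ _ I′p)

    r≤n∸γ : r ≤ n ∸ γ
    r≤n∸γ = count-subset γ≤n I′⊆S

    regroup₁ : ∀ a b c e → a + b + (c + e) ≡ a + c + e + b
    regroup₁ = solve-∀
    regroup₂ : ∀ c D e y → c + D + e + y ≡ D + y + (c + e)
    regroup₂ = solve-∀

lemma11 : (n : ℕ) (d : Fin n → ℕ) (γ : ℕ)
    → (∀ (p q : Fin n) → p ≤F q → d q ≤ d p)
    → (∀ (p : Fin n) → 1 ≤ d p)
    → 1 ≤ γ → γ ≤ n
    → ((∀ (I J : Fin n → Bool) → SubsetS γ I → SubsetS γ J
          → ΣFin n d ≤ capacity n γ d (F1cut n γ I J))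
       ⇔ (∀ (k : ℕ) → k ≤ n ∸ γ
          → + ΣRange n γ (γ + k) (λ p → d p ∸ 1)
            ≤ℤ (((+ (k * (k ∸ 1)) - + (n ∸ γ)) +ℤ + ΣRange n 0 γ d)
                 +ℤ + ΣRange n (γ + k) n (λ p → k ⊓ (d p ∸ 1)))))
lemma11 n d γ d↓ d≥1 _ γ≤n = mk⇔
  (λ cut-bounds k k≤n∸γ →
     Equivalence.from (condition⇔ k) (cut-bounds⇒Condition d≥1 γ≤n cut-bounds k k≤n∸γ))
  (λ inequalities I J I⊆S J⊆S →
     Equivalence.from (F1cut-condition⇔ d≥1 γ≤n I⊆S J⊆S)
       (Conditions⇒cut-bound d↓ γ≤n
          (λ k k≤n∸γ → Equivalence.to (condition⇔ k) (inequalities k k≤n∸γ)) J I⊆S))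
  where open Network n γ d
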